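{- The family $\mathcal{F}$ of $2$-edge-coloured graphs whose underlying graph is a partial $2$-tree is not optimally simply colourable, i.e. $\chi_s(\mathcal{F})\neq\chi(\mathcal{F})$.
   Context: A $2$-edge-coloured graph is a simple undirected graph with each edge assigned one of two colours. A homomorphism $\phi: G\to H$ is a map $V(G)\to V(H)$ such that every edge $uv$ maps to an edge $\phi(u)\phi(v)$ of the same colour (in particular $\phi(u)\neq\phi(v)$); $\chi(G)$ is the least number of vertices of an $H$ with $G\to H$. A simple homomorphism $\phi: G\to_s H$ is a map such that either $|V(G)|=1$, or $\phi$ is non-constant and every edge $uv$ with $\phi(u)\neq\phi(v)$ maps to an edge of $H$ of the same colour; $\chi_s(G)$ is the least number of vertices of an $H$ with $G\to_s H$. For a family $\mathcal{F}$, $\chi(\mathcal{F})$ (resp. $\chi_s(\mathcal{F})$) is the maximum of $\chi(G)$ (resp. $\chi_s(G)$) over $G\in\mathcal{F}$ ($\infty$ if no maximum exists); $\mathcal{F}$ is optimally simply colourable if these are equal. A partial $2$-tree is a subgraph of a $2$-tree. -}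

module Defs where

open import Data.Nat using (ℕ; zero; suc; _≤_)
open import Data.Fin using (Fin; zero; suc)
open import Data.Maybe using (Maybe; just; nothing)
open import Data.Product using (Σ; _×_; ∃; ∃-syntax)
open import Data.Sum using (_⊎_)
open import Data.Unit using (⊤)
open import Data.Empty using (⊥)
open import Relation.Nullary using (¬_)
open import Relation.Binary.PropositionalEquality using (_≡_; _≢_)
open import Function.Definitions using (Injective)

Colour : Set
Colour = Fin 2

-- A (finite, simple, undirected) 2-edge-coloured graph on vertex set Fin size:
-- col x y = nothing means no edge, just c means an edge of colour c.
record CGraph : Set where
  field
    size : ℕ
    col  : Fin size → Fin size → Maybe Colour
    sym  : ∀ x y → col x y ≡ col y x
    irr  : ∀ x → col x x ≡ nothing
open CGraph public

Hom : (G H : CGraph) → (Fin (size G) → Fin (size H)) → Set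
Hom G H φ = ∀ u v (c : Colour) → col G u v ≡ just c → col H (φ u) (φ v) ≡ just c

NonConstant : {A B : Set} → (A → B) → Set
NonConstant {A} φ = Σ A λ u → Σ A λ v → φ u ≢ φ v

SimpleHom : (G H : CGraph) → (Fin (size G) → Fin (size H)) → Set
SimpleHom G H φ =
  size G ≡ 1 ⊎
  (NonConstant φ ×
   (∀ u v (c : Colour) → col G u v ≡ just c → φ u ≢ φ v → col H (φ u) (φ v) ≡ just c))

IsChi : CGraph → ℕ → Set
IsChi G k =
  (Σ CGraph λ H → size H ≡ k × Σ (Fin (size G) → Fin (size H)) (Hom G H)) ×
  (∀ (H : CGraph) (φ : Fin (size G) → Fin (size H)) → Hom G H φ → k ≤ size H)

IsChiS : CGraph → ℕ → Set
IsChiS G k =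
  (Σ CGraph λ H → size H ≡ k × Σ (Fin (size G) → Fin (size H)) (SimpleHom G H)) ×
  (∀ (H : CGraph) (φ : Fin (size G) → Fin (size H)) → SimpleHom G H φ → k ≤ size H)

-- 2-trees (on vertex set Fin n), built from K₂ by repeatedly adding a new
-- vertex adjacent to both ends of an existing edge.  The new vertex is `zero`,
-- old vertices are shifted by `suc`.
mutual
  data TwoTree : ℕ → Set where
    base : TwoTree 2
    add  : ∀ {n} (T : TwoTree n) (u v : Fin n) → Adj T u v → TwoTree (suc n)

  Adj : ∀ {n} → TwoTree n → Fin n → Fin n → Set
  Adj base zero zero = ⊥
  Adj base zero (suc _) = ⊤
  Adj base (suc _) zero = ⊤
  Adj base (suc _) (suc _) = ⊥
  Adj (add T u v e) zero zero = ⊥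
  Adj (add T u v e) zero (suc y) = y ≡ u ⊎ y ≡ v
  Adj (add T u v e) (suc x) zero = x ≡ u ⊎ x ≡ v
  Adj (add T u v e) (suc x) (suc y) = Adj T x y

PartialTwoTree : CGraph → Set
PartialTwoTree G =
  1 ≤ size G ×
  Σ ℕ λ m → Σ (TwoTree m) λ T → Σ (Fin (size G) → Fin m) λ f →
    Injective _≡_ _≡_ f × (∀ u v (c : Colour) → col G u v ≡ just c → Adj T (f u) (f v))

-- Value of a family parameter: just k = maximum k attained; nothing = ∞ (no maximum).
FamValue : (CGraph → ℕ → Set) → (CGraph → Set) → Maybe ℕ → Set
FamValue ι F (just k) =
  (Σ CGraph λ G → F G × ι G k) × (∀ G → F G → ∀ j → ι G j → j ≤ k)
FamValue ι F nothing = ∀ k → ¬ FamValue ι F (just k)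

-- A partial 2-tree with at least two vertices has a simple homomorphism onto a one-coloured
-- K₂: a nontrivial bipartition all of whose crossing edges share one colour.  This goes by
-- induction along the construction of the host 2-tree: the last added vertex is adjacent only to
-- u and v, so it can join the side of u or of v unless both of its edges have the colour other
-- than that of the cut, and then it is cut off on its own.  Hence χₛ = 2 on the family, while the
-- monochromatic triangle is a 2-tree with χ = 3.
module Submission where

open import Defs
open import Data.Nat using (ℕ)
open import Data.Maybe using (Maybe)
open import Relation.Binary.PropositionalEquality using (_≢_)

open import Data.Nat using (zero; suc; _≤_; s≤s; z≤n)
open import Data.Nat.Properties using (m≤n⇒m<n∨m≡n; <⇒≱)
open import Data.Fin using (Fin; zero; suc; _≟_)
open import Data.Fin.Properties using (any?; injective⇒≤)
open import Data.Maybe using (just; nothing)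
open import Data.Maybe.Relation.Unary.All using (All; just; nothing; drop-just)
open import Data.Product using (Σ; ∃; ∃₂; _×_; _,_; proj₁; proj₂)
open import Data.Sum using (_⊎_; inj₁; inj₂; swap)
open import Data.Unit using (tt)
open import Data.Vec.Functional using (_∷_)
open import Function using (id; _∘_; const)
open import Level using (0ℓ)
open import Relation.Nullary using (¬_; Dec; yes; no; contradiction)
open import Relation.Nullary.Decidable using (_×-dec_; ¬?)
open import Relation.Unary using (Pred; Decidable)
open import Relation.Binary.PropositionalEquality as ≡ using (_≡_; refl; trans; subst; cong)

other-colour-unique : ∀ {a b c : Colour} → a ≢ c → b ≢ c → a ≡ b
other-colour-unique {zero}     {zero}               _   _   = refl
other-colour-unique {suc zero} {suc zero}           _   _   = refl
other-colour-unique {zero}     {suc zero} {zero}     a≢c _   = contradiction refl a≢c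
other-colour-unique {zero}     {suc zero} {suc zero} _   b≢c = contradiction refl b≢c
other-colour-unique {suc zero} {zero}     {zero}     _   b≢c = contradiction refl b≢c
other-colour-unique {suc zero} {zero}     {suc zero} a≢c _   = contradiction refl a≢c

sole-colour : (m : Maybe Colour) → ∃ λ d → All (_≡ d) m
sole-colour nothing  = zero , nothing
sole-colour (just d) = d , just refl

all-or-common : (c : Colour) (m₁ m₂ : Maybe Colour) →
  All (_≡ c) m₁ ⊎ All (_≡ c) m₂ ⊎ ∃ λ d → All (_≡ d) m₁ × All (_≡ d) m₂
all-or-common c nothing   _         = inj₁ nothing
all-or-common c (just _)  nothing   = inj₂ (inj₁ nothing)
all-or-common c (just d₁) (just d₂) with d₁ ≟ c | d₂ ≟ c
... | yes d₁≡c | _        = inj₁ (just d₁≡c)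
... | no _     | yes d₂≡c = inj₂ (inj₁ (just d₂≡c))
... | no d₁≢c  | no d₂≢c  =
  inj₂ (inj₂ (d₁ , just refl , just (other-colour-unique d₂≢c d₁≢c)))

edge⇒≢ : ∀ (G : CGraph) {x y c} → col G x y ≡ just c → x ≢ y
edge⇒≢ G {x} e refl with () ← trans (≡.sym (irr G x)) e

distinct⇒2≤ : ∀ {n} {p q : Fin n} → p ≢ q → 2 ≤ n
distinct⇒2≤ {suc zero}    {zero} {zero} p≢q = contradiction refl p≢q
distinct⇒2≤ {suc (suc _)}                _   = s≤s (s≤s z≤n)

2≤⇒distinct : ∀ {n} → 2 ≤ n → ∃₂ λ (p q : Fin n) → p ≢ q
2≤⇒distinct (s≤s (s≤s _)) = zero , suc zero , λ ()

hom-injective-on-edges : ∀ {G H φ} → Hom G H φ → ∀ {x y c} → col G x y ≡ just c → φ x ≢ φ y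
hom-injective-on-edges {H = H} hom e = edge⇒≢ H (hom _ _ _ e)

simpleHom⇒2≤size : ∀ {G H φ} → size G ≢ 1 → SimpleHom G H φ → 2 ≤ size H
simpleHom⇒2≤size size≢1 (inj₁ size≡1)                 = contradiction size≡1 size≢1
simpleHom⇒2≤size _      (inj₂ ((_ , _ , φu≢φv) , _)) = distinct⇒2≤ φu≢φv

module _ (n : ℕ) (c : Colour) where

  complete-col : Fin n → Fin n → Maybe Colour
  complete-col x y with x ≟ y
  ... | yes _ = nothing
  ... | no _  = just c

  Complete : CGraph
  Complete = record { size = n ; col = complete-col ; sym = col-sym ; irr = col-irr }
    where
    col-sym : ∀ x y → complete-col x y ≡ complete-col y x
    col-sym x y with x ≟ y | y ≟ x
    ... | yes _   | yes _   = refl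
    ... | no _    | no _    = refl
    ... | yes x≡y | no y≢x  = contradiction (≡.sym x≡y) y≢x
    ... | no x≢y  | yes y≡x = contradiction (≡.sym y≡x) x≢y
    col-irr : ∀ x → complete-col x x ≡ nothing
    col-irr x with x ≟ x
    ... | yes _   = refl
    ... | no x≢x  = contradiction refl x≢x

module _ {n : ℕ} {c : Colour} where

  Complete-col-≢ : ∀ {x y} → x ≢ y → col (Complete n c) x y ≡ just c
  Complete-col-≢ {x} {y} x≢y with x ≟ y
  ... | yes x≡y = contradiction x≡y x≢y
  ... | no _    = refl

  χ-Complete : IsChi (Complete n c) n
  χ-Complete = (Complete n c , refl , id , λ _ _ _ e → e) , lower
    where
    lower : ∀ H φ → Hom (Complete n c) H φ → n ≤ size H
    lower H φ hom = injective⇒≤ φ-injective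
      where
      φ-injective : ∀ {x y} → φ x ≡ φ y → x ≡ y
      φ-injective {x} {y} φx≡φy with x ≟ y
      ... | yes x≡y = x≡y
      ... | no x≢y  = contradiction φx≡φy
                        (hom-injective-on-edges {Complete n c} {H} hom (Complete-col-≢ x≢y))

  Complete-partialTwoTree : 1 ≤ n → (T : TwoTree n) → (∀ {x y} → x ≢ y → Adj T x y) →
                            PartialTwoTree (Complete n c)
  Complete-partialTwoTree 1≤n T adj =
    1≤n , n , T , id , id , λ _ _ _ e → adj (edge⇒≢ (Complete n c) e)

χs-Complete-2 : ∀ {c} → IsChiS (Complete 2 c) 2
χs-Complete-2 {c} = (Complete 2 c , refl , id , identity-simple) , lower
  where
  identity-simple : SimpleHom (Complete 2 c) (Complete 2 c) id
  identity-simple = inj₂ ((zero , suc zero , λ ()) , λ _ _ _ e _ → e)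
  lower : ∀ H φ → SimpleHom (Complete 2 c) H φ → 2 ≤ size H
  lower H _ = simpleHom⇒2≤size {Complete 2 c} {H} λ ()

-- The induction runs over the host 2-tree, not all of whose vertices belong to the graph.
record ColouredSubgraph {m} (T : TwoTree m) : Set₁ where
  field
    Vertex      : Pred (Fin m) 0ℓ
    vertex?     : Decidable Vertex
    edge        : Fin m → Fin m → Maybe Colour
    edge-sym    : ∀ a b → edge a b ≡ edge b a
    edge⇒Adj    : ∀ {a b d} → edge a b ≡ just d → Adj T a b
    edge⇒Vertex : ∀ {a b d} → edge a b ≡ just d → Vertex a

  no-edge-at : ∀ {P : Pred Colour 0ℓ} {a} → ¬ Vertex a → ∀ b → All P (edge a b)
  no-edge-at {a = a} ¬va b with edge a b in e
  ... | nothing = nothing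
  ... | just _  = contradiction (edge⇒Vertex e) ¬va

open ColouredSubgraph

-- Restricted to the vertices of S, this is a simple homomorphism onto a one-coloured K₂.
record MonochromaticCut {m} {T : TwoTree m} (S : ColouredSubgraph T) : Set where
  field
    colour    : Colour
    side      : Fin m → Fin 2
    separates : ∃₂ λ a b → Vertex S a × Vertex S b × side a ≢ side b
    cut-edges : ∀ a b → side a ≢ side b → All (_≡ colour) (edge S a b)

open MonochromaticCut

restrict : ∀ {m} {T : TwoTree m} {u v e} → ColouredSubgraph (add T u v e) → ColouredSubgraph T
restrict S = record
  { Vertex      = Vertex S ∘ suc
  ; vertex?     = vertex? S ∘ suc
  ; edge        = λ a b → edge S (suc a) (suc b)
  ; edge-sym    = λ a b → edge-sym S (suc a) (suc b)
  ; edge⇒Adj    = edge⇒Adj S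
  ; edge⇒Vertex = edge⇒Vertex S
  }

base-cut : (S : ColouredSubgraph base) → ∀ {x y} → x ≢ y → Vertex S x → Vertex S y →
           MonochromaticCut S
base-cut S {x} {y} x≢y vx vy = record
  { colour = proj₁ d₀
  ; side = id
  ; separates = x , y , vx , vy , x≢y
  ; cut-edges = cut
  }
  where
  d₀ = sole-colour (edge S zero (suc zero))
  cut : ∀ a b → a ≢ b → All (_≡ proj₁ d₀) (edge S a b)
  cut zero       zero       a≢b = contradiction refl a≢b
  cut zero       (suc zero) _   = proj₂ d₀
  cut (suc zero) zero       _   = subst (All _) (edge-sym S zero (suc zero)) (proj₂ d₀)
  cut (suc zero) (suc zero) a≢b = contradiction refl a≢b

module AddVertex {m} {T : TwoTree m} {u v : Fin m} {e : Adj T u v}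
            (S : ColouredSubgraph (add T u v e))
            (ih : ∀ {x y} → x ≢ y → Vertex S (suc x) → Vertex S (suc y) →
                  MonochromaticCut (restrict S)) where

  private
    E₀ : Fin m → Maybe Colour
    E₀ b = edge S zero (suc b)

  extend-side : ∀ {c} (s₀ : Fin 2) (side : Fin m → Fin 2) →
    (∀ b → s₀ ≢ side b → All (_≡ c) (E₀ b)) →
    (∀ a b → side a ≢ side b → All (_≡ c) (edge S (suc a) (suc b))) →
    ∀ a b → (s₀ ∷ side) a ≢ (s₀ ∷ side) b → All (_≡ c) (edge S a b)
  extend-side s₀ side new old zero    zero    s≢s = contradiction refl s≢s
  extend-side s₀ side new old zero    (suc b) s≢s = new b s≢s
  extend-side s₀ side new old (suc a) zero    s≢s =
    subst (All _) (edge-sym S zero (suc a)) (new a (s≢s ∘ ≡.sym))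
  extend-side s₀ side new old (suc a) (suc b) s≢s = old a b s≢s

  extend-cut : (C : MonochromaticCut (restrict S)) (s₀ : Fin 2) →
    (∀ b → s₀ ≢ side C b → All (_≡ colour C) (E₀ b)) → MonochromaticCut S
  extend-cut C s₀ new = record
    { colour = colour C
    ; side = s₀ ∷ side C
    ; separates = let a , b , va , vb , a≢b = separates C in suc a , suc b , va , vb , a≢b
    ; cut-edges = extend-side s₀ (side C) new (cut-edges C)
    }

  isolate-new : ∀ {w d} → Vertex S zero → Vertex S (suc w) → (∀ b → All (_≡ d) (E₀ b)) →
                MonochromaticCut S
  isolate-new {w} {d} v₀ vw new = record
    { colour = d
    ; side = zero ∷ const (suc zero)
    ; separates = zero , suc w , v₀ , vw , λ ()
    ; cut-edges = extend-side zero (const (suc zero)) (λ b _ → new b)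
                    (λ _ _ 1≢1 → contradiction refl 1≢1)
    }

  -- The new vertex zero is adjacent in the 2-tree only to u and v.
  all-new-edges : ∀ {P : Pred Colour 0ℓ} → All P (E₀ u) → All P (E₀ v) → ∀ b → All P (E₀ b)
  all-new-edges Pu Pv b with E₀ b in e₀
  ... | nothing = nothing
  ... | just _ with edge⇒Adj S e₀
  ...   | inj₁ refl = subst (All _) e₀ Pu
  ...   | inj₂ refl = subst (All _) e₀ Pv

  join-side-of : ∀ {c} (p q : Fin m) → (∀ {b d} → E₀ b ≡ just d → b ≡ p ⊎ b ≡ q) →
    All (_≡ c) (E₀ p) → (side : Fin m → Fin 2) → ∀ b → side q ≢ side b → All (_≡ c) (E₀ b)
  join-side-of p q nb Pp side b q≢b with E₀ b in e₀
  ... | nothing = nothing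
  ... | just _ with nb e₀
  ...   | inj₁ refl = subst (All _) e₀ Pp
  ...   | inj₂ refl = contradiction refl q≢b

  place-new : MonochromaticCut (restrict S) → MonochromaticCut S
  place-new C with vertex? S zero
  ... | no ¬v₀ = extend-cut C zero (λ b _ → no-edge-at S ¬v₀ (suc b))
  ... | yes v₀ with all-or-common (colour C) (E₀ u) (E₀ v)
  ...   | inj₁ Pu        = extend-cut C (side C v) (join-side-of u v (edge⇒Adj S) Pu (side C))
  ...   | inj₂ (inj₁ Pv) = extend-cut C (side C u)
                             (join-side-of v u (swap ∘ edge⇒Adj S) Pv (side C))
  ...   | inj₂ (inj₂ (d , Pu , Pv)) =
    let a , _ , va , _ = separates C in isolate-new v₀ va (all-new-edges Pu Pv)

  -- If y is the only old vertex, every edge at the new vertex goes to y.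
  cut-with-new : ∀ {y} → Vertex S zero → Vertex S (suc y) → MonochromaticCut S
  cut-with-new {y} v₀ vy with any? (λ w → vertex? S (suc w) ×-dec ¬? (w ≟ y))
  ... | yes (w , vw , w≢y) = place-new (ih w≢y vw vy)
  ... | no no-other        = isolate-new v₀ vy sole-edge
    where
    d₀ = sole-colour (E₀ y)
    sole-edge : ∀ b → All (_≡ proj₁ d₀) (E₀ b)
    sole-edge b with b ≟ y
    ... | yes refl = proj₂ d₀
    ... | no b≢y   = subst (All _) (edge-sym S (suc b) zero)
                       (no-edge-at S (λ vb → no-other (b , vb , b≢y)) zero)

  cut : ∀ {x y} → x ≢ y → Vertex S x → Vertex S y → MonochromaticCut S
  cut {zero}  {zero}  x≢y _  _  = contradiction refl x≢y
  cut {zero}  {suc _} _   v₀ vy = cut-with-new v₀ vy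
  cut {suc _} {zero}  _   vx v₀ = cut-with-new v₀ vx
  cut {suc _} {suc _} x≢y vx vy = place-new (ih (x≢y ∘ cong suc) vx vy)

monochromaticCut : ∀ {m} {T : TwoTree m} (S : ColouredSubgraph T) → ∀ {x y} → x ≢ y →
                   Vertex S x → Vertex S y → MonochromaticCut S
monochromaticCut {T = base}        S = base-cut S
monochromaticCut {T = add T u v e} S = AddVertex.cut S (monochromaticCut (restrict S))

module Image (G : CGraph) {m} (T : TwoTree m) (f : Fin (size G) → Fin m)
             (f-injective : ∀ {x y} → f x ≡ f y → x ≡ y)
             (col⇒Adj : ∀ x y c → col G x y ≡ just c → Adj T (f x) (f y)) where

  InImage : Pred (Fin m) 0ℓ
  InImage a = ∃ λ x → f x ≡ a

  edge-between : ∀ {a b} → Dec (InImage a) → Dec (InImage b) → Maybe Colour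
  edge-between (yes (x , _)) (yes (y , _)) = col G x y
  edge-between _             _             = nothing

  edge-between-sym : ∀ {a b} (da : Dec (InImage a)) (db : Dec (InImage b)) →
                     edge-between da db ≡ edge-between db da
  edge-between-sym (yes (x , _)) (yes (y , _)) = CGraph.sym G x y
  edge-between-sym (yes _)       (no _)        = refl
  edge-between-sym (no _)        (yes _)       = refl
  edge-between-sym (no _)        (no _)        = refl

  edge-between⇒Adj : ∀ {a b d} (da : Dec (InImage a)) (db : Dec (InImage b)) →
                     edge-between da db ≡ just d → Adj T a b
  edge-between⇒Adj (yes (x , refl)) (yes (y , refl)) e = col⇒Adj x y _ e

  edge-between⇒InImage : ∀ {a b d} (da : Dec (InImage a)) (db : Dec (InImage b)) →
                         edge-between da db ≡ just d → InImage a
  edge-between⇒InImage (yes xa) (yes _) _ = xa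

  inImage? : Decidable InImage
  inImage? a = any? (λ x → f x ≟ a)

  image : ColouredSubgraph T
  image = record
    { Vertex      = InImage
    ; vertex?     = inImage?
    ; edge        = λ a b → edge-between (inImage? a) (inImage? b)
    ; edge-sym    = λ a b → edge-between-sym (inImage? a) (inImage? b)
    ; edge⇒Adj    = λ {a b} → edge-between⇒Adj (inImage? a) (inImage? b)
    ; edge⇒Vertex = λ {a b} → edge-between⇒InImage (inImage? a) (inImage? b)
    }

  edge-image : ∀ x y → edge image (f x) (f y) ≡ col G x y
  edge-image x y with inImage? (f x) | inImage? (f y)
  ... | yes (x′ , fx′≡fx) | yes (y′ , fy′≡fy) with f-injective fx′≡fx | f-injective fy′≡fy
  ...   | refl | refl = refl
  edge-image x y | no ∉ | _  = contradiction (x , refl) ∉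
  edge-image x y | _ | no ∉  = contradiction (y , refl) ∉

  cut⇒simpleHom : (C : MonochromaticCut image) →
                  SimpleHom G (Complete 2 (colour C)) (side C ∘ f)
  cut⇒simpleHom C = inj₂ (nonconstant , cut-edge)
    where
    nonconstant : NonConstant (side C ∘ f)
    nonconstant with separates C
    ... | _ , _ , (x , refl) , (y , refl) , fx≢fy = x , y , fx≢fy
    cut-edge : ∀ x y d → col G x y ≡ just d → side C (f x) ≢ side C (f y) →
               col (Complete 2 (colour C)) (side C (f x)) (side C (f y)) ≡ just d
    cut-edge x y d e across = trans (Complete-col-≢ across) (cong just (≡.sym d≡colour))
      where
      d≡colour : d ≡ colour C
      d≡colour = drop-just
        (subst (All _) (trans (edge-image x y) e) (cut-edges C (f x) (f y) across))

partialTwoTree⇒simpleHom-K₂ : ∀ G → PartialTwoTree G →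
  ∃ λ c → Σ (Fin (size G) → Fin 2) (SimpleHom G (Complete 2 c))
partialTwoTree⇒simpleHom-K₂ G (1≤size , _ , T , f , f-injective , col⇒Adj)
  with m≤n⇒m<n∨m≡n 1≤size
... | inj₂ 1≡size = zero , const zero , inj₁ (≡.sym 1≡size)
... | inj₁ 2≤size =
  let x , y , x≢y = 2≤⇒distinct 2≤size
      C = monochromaticCut image (x≢y ∘ f-injective) (x , refl) (y , refl)
  in colour C , side C ∘ f , cut⇒simpleHom C
  where open Image G T f f-injective col⇒Adj

χs-partialTwoTree≤2 : ∀ G {k} → PartialTwoTree G → IsChiS G k → k ≤ 2
χs-partialTwoTree≤2 G F (_ , minimal) =
  let c , φ , simple = partialTwoTree⇒simpleHom-K₂ G F in minimal (Complete 2 c) φ simple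

χs-partialTwoTrees : FamValue IsChiS PartialTwoTree (just 2)
χs-partialTwoTrees =
  (Complete 2 zero , Complete-partialTwoTree (s≤s z≤n) base adj , χs-Complete-2) ,
  λ G F _ → χs-partialTwoTree≤2 G F
  where
  adj : ∀ {x y} → x ≢ y → Adj base x y
  adj {zero}     {zero}     x≢y = contradiction refl x≢y
  adj {zero}     {suc zero} _   = tt
  adj {suc zero} {zero}     _   = tt
  adj {suc zero} {suc zero} x≢y = contradiction refl x≢y

triangle : TwoTree 3
triangle = add base zero (suc zero) tt

χ-partialTwoTrees-≥3 : ∀ {k} → FamValue IsChi PartialTwoTree (just k) → 3 ≤ k
χ-partialTwoTrees-≥3 (_ , maximal) =
  maximal (Complete 3 zero) (Complete-partialTwoTree (s≤s z≤n) triangle adj) 3 χ-Complete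
  where
  adj : ∀ {x y} → x ≢ y → Adj triangle x y
  adj {zero}           {zero}           x≢y = contradiction refl x≢y
  adj {zero}           {suc zero}       _   = inj₁ refl
  adj {zero}           {suc (suc zero)} _   = inj₂ refl
  adj {suc zero}       {zero}           _   = inj₁ refl
  adj {suc zero}       {suc zero}       x≢y = contradiction refl x≢y
  adj {suc zero}       {suc (suc zero)} _   = tt
  adj {suc (suc zero)} {zero}           _   = inj₂ refl
  adj {suc (suc zero)} {suc zero}       _   = tt
  adj {suc (suc zero)} {suc (suc zero)} x≢y = contradiction refl x≢y

FamValue-≤ : ∀ {ι F k l} → FamValue ι F (just k) → FamValue ι F (just l) → k ≤ l
FamValue-≤ ((G , FG , ιGk) , _) (_ , maximal) = maximal G FG _ ιGk

mainTheorem20 : ∀ (a b : Maybe ℕ) → FamValue IsChiS PartialTwoTree a → FamValue IsChi PartialTwoTree b → a ≢ b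
mainTheorem20 nothing  _        χs=∞ _   _    = χs=∞ 2 χs-partialTwoTrees
mainTheorem20 (just _) nothing  _    _   ()
mainTheorem20 (just k) (just k) χs=k χ=k refl =
  <⇒≱ (χ-partialTwoTrees-≥3 χ=k) (FamValue-≤ χs=k χs-partialTwoTrees)
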